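{- The order of a $[z,r;g]$-mixed cage is at least $n_0(r,g)+2z$.
   Context: A mixed graph is a finite simple graph that may contain both (undirected) edges and (directed) arcs, with no multiple edges or arcs. It is $z$-regular by arcs and $r$-regular by edges if every vertex is the head of exactly $z$ arcs, the tail of exactly $z$ arcs, and is incident with exactly $r$ edges. Cycles are sequences of vertices where consecutive vertices are joined by an edge or by an arc traversed in its direction; the girth is the length of a shortest cycle. A $[z,r;g]$-mixed graph is a mixed graph that is $z$-regular by arcs, $r$-regular by edges and has girth $g$; a $[z,r;g]$-mixed cage is a $[z,r;g]$-mixed graph of minimum order. $n_0(r,g)$ denotes the Moore bound: $n_0(r,g)=1+r\sum_{i=0}^{(g-3)/2}(r-1)^i$ for odd $g$ and $n_0(r,g)=2\sum_{i=0}^{(g-2)/2}(r-1)^i$ for even $g$. -}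

module Defs where

open import Data.Nat using (ℕ; zero; suc; _+_; _*_; _∸_; _^_; _≤_; _<_)
open import Data.Nat.Base using (_/_; _%_)
open import Data.Bool using (Bool; true; false; if_then_else_)
open import Data.Fin using (Fin; zero; suc; inject₁; fromℕ)
open import Data.Product using (Σ; _×_; ∃)
open import Data.Sum using (_⊎_)
open import Relation.Binary.PropositionalEquality using (_≡_)
open import Relation.Nullary using (¬_)
open import Function.Definitions using (Injective)

count : ∀ {n} → (Fin n → Bool) → ℕ
count {zero}  p = 0
count {suc n} p = (if p zero then 1 else 0) + count (λ i → p (suc i))

-- A mixed graph on the vertex set Fin n.
-- edge u v : u and v are joined by an (undirected) edge
-- arc u v  : there is an arc from u (tail) to v (head)
record MixedGraph (n : ℕ) : Set where
  field
    edge : Fin n → Fin n → Bool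
    arc  : Fin n → Fin n → Bool
    edge-sym     : ∀ u v → edge u v ≡ edge v u
    edge-irrefl  : ∀ v → edge v v ≡ false
    arc-irrefl   : ∀ v → arc v v ≡ false
    -- simplicity: any pair of vertices is joined by at most one edge or arc
    edge-not-arc : ∀ u v → edge u v ≡ true → arc u v ≡ false
    arc-not-back : ∀ u v → arc u v ≡ true → arc v u ≡ false

open MixedGraph public

Step : ∀ {n} → MixedGraph n → Fin n → Fin n → Set
Step G u v = (edge G u v ≡ true) ⊎ (arc G u v ≡ true)

HasCycleOfLength : ∀ {n} → MixedGraph n → ℕ → Set
HasCycleOfLength {n} G zero = Data.Empty.⊥
  where import Data.Empty
HasCycleOfLength {n} G (suc m) =
  (3 ≤ suc m) ×
  Σ (Fin (suc m) → Fin n) λ c →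
    Injective _≡_ _≡_ c ×
    ((i : Fin m) → Step G (c (inject₁ i)) (c (suc i))) ×
    Step G (c (fromℕ m)) (c zero)

HasGirth : ∀ {n} → MixedGraph n → ℕ → Set
HasGirth G g = HasCycleOfLength G g × (∀ k → k < g → ¬ HasCycleOfLength G k)

IsRegular : ∀ {n} → MixedGraph n → ℕ → ℕ → Set
IsRegular {n} G z r =
  (∀ v → count (λ u → arc G v u) ≡ z) ×
  (∀ v → count (λ u → arc G u v) ≡ z) ×
  (∀ v → count (λ u → edge G v u) ≡ r)

IsMixedGraphZRG : ℕ → ℕ → ℕ → ∀ {n} → MixedGraph n → Set
IsMixedGraphZRG z r g G = IsRegular G z r × HasGirth G g

ExistsMixedGraph : ℕ → ℕ → ℕ → ℕ → Set
ExistsMixedGraph z r g n = Σ (MixedGraph n) λ G → IsMixedGraphZRG z r g G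

IsMixedCage : ℕ → ℕ → ℕ → ∀ {n} → MixedGraph n → Set
IsMixedCage z r g {n} G =
  IsMixedGraphZRG z r g G × (∀ m → ExistsMixedGraph z r g m → n ≤ m)

geomSum : ℕ → ℕ → ℕ
geomSum b zero    = 1
geomSum b (suc k) = geomSum b k + b ^ suc k

n₀ : ℕ → ℕ → ℕ
n₀ r g with g % 2
... | zero  = 2 * geomSum (r ∸ 1) ((g ∸ 2) / 2)
... | suc _ = 1 + r * geomSum (r ∸ 1) ((g ∸ 3) / 2)

-- For odd g take a vertex v, for even g an edge uv.  The non-backtracking edge walks of
-- length at most ⌊(g-1)/2⌋ starting at v (resp. at u or at v, not along uv) end in distinct
-- vertices: two of them with a common end would combine into a non-backtracking closed
-- walk shorter than g, and such a walk contains a cycle that is no longer.  There are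
-- n₀(r,g) such walks.  The z out- and z in-neighbours of v (resp. u) along arcs are
-- distinct and lie outside this Moore tree, since an arc between the root and a tree
-- vertex also closes a short non-backtracking walk.  Hence n ≥ n₀(r,g) + 2z.

module Submission where

open import Defs
open import Data.Nat using (_/_; _%_; ℕ; zero; suc; _+_; _*_; _∸_; _^_; _≤_; _<_; s≤s; z≤n)
open import Data.Nat.Properties
open import Data.Nat.DivMod using (m/n*n≤m)
open import Data.Bool using (Bool; true; false)
open import Data.Bool.Properties using () renaming (_≟_ to _≟ᵇ_)
open import Data.Fin as Fin using (Fin)
open import Data.Fin.Properties using (injective⇒≤) renaming (_≟_ to _≟ᶠ_)
open import Data.List using (List; []; _∷_; [_]; _++_; _ʳ++_; length; map; filter; concatMap; tabulate; allFin; lookup; head; last)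
open import Data.List.Properties using (length-map; ∷-injectiveˡ; ∷-injectiveʳ; length-++; length-ʳ++; ++-assoc; filter-all; filter-accept; filter-reject)
open import Data.List.Relation.Unary.All as All using (All; []; _∷_)
import Data.List.Relation.Unary.All.Properties as All
open import Data.List.Relation.Unary.AllPairs as AllPairs using ([]; _∷_)
import Data.List.Relation.Unary.AllPairs.Properties as AllPairs
open import Data.List.Relation.Binary.Disjoint.Propositional using (Disjoint)
open import Data.List.Relation.Unary.Any using (here; there)
open import Data.List.Relation.Unary.Unique.Propositional using (Unique)
import Data.List.Relation.Unary.Unique.Propositional.Properties as Unique
open import Data.List.Membership.Propositional using (_∈_; _∉_)
open import Data.List.Membership.Propositional.Properties using (∈-++⁻; ∈-lookup; ∈-filter⁺; ∈-filter⁻; ∈-allFin; ∈-∃++; ∈-map⁻)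
open import Data.Maybe using (just)
open import Data.Product using (∃; _×_; _,_; proj₂)
open import Data.Empty using (⊥)
open import Data.Sum using (_⊎_; inj₁; inj₂)
open import Relation.Binary.PropositionalEquality using (_≡_; _≢_; refl; sym; trans; cong; cong₂; subst; module ≡-Reasoning)
open import Relation.Nullary using (¬_; ¬?; Dec; yes; no)
open import Relation.Nullary.Negation using (contradiction)
open import Function using (id; _∘_; flip)
open import Data.List.Relation.Unary.Linked as Linked using (Linked; []; [-]; _∷_)
import Data.List.Relation.Unary.Linked.Properties as Linked
open import Data.Maybe.Relation.Binary.Connected as Connected using (Connected; just; just-nothing)

private variable
  A : Set
  n : ℕ

select : (Fin n → Bool) → List (Fin n)
select p = filter (λ v → p v ≟ᵇ true) (allFin _)

length-select : (p : Fin n → Bool) → length (select p) ≡ count p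
length-select p = go id
  where
  go : ∀ {m} (f : Fin m → Fin _) →
       length (filter (λ v → p v ≟ᵇ true) (tabulate f)) ≡ count (p ∘ f)
  go {zero}  f = refl
  go {suc m} f with p (f Fin.zero)
  ... | true  = cong suc (go (f ∘ Fin.suc))
  ... | false = go (f ∘ Fin.suc)

select-unique : (p : Fin n → Bool) → Unique (select p)
select-unique p = Unique.filter⁺ _ (Unique.allFin⁺ _)

∈-select⁺ : (p : Fin n → Bool) {v : Fin n} → p v ≡ true → v ∈ select p
∈-select⁺ p {v} pv = ∈-filter⁺ (λ v → p v ≟ᵇ true) (∈-allFin v) pv

∈-select⁻ : {p : Fin n → Bool} {v : Fin n} → v ∈ select p → p v ≡ true
∈-select⁻ {p = p} v∈ = proj₂ (∈-filter⁻ (λ v → p v ≟ᵇ true) {xs = allFin _} v∈)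

lookup-injective : {xs : List A} → Unique xs → ∀ {i j} → lookup xs i ≡ lookup xs j → i ≡ j
lookup-injective {xs = _ ∷ _}  (_ ∷ _)    {Fin.zero}  {Fin.zero}  _ = refl
lookup-injective {xs = _ ∷ xs} (x∉ ∷ _)   {Fin.zero}  {Fin.suc j} e = contradiction e (All.lookup x∉ (∈-lookup j))
lookup-injective {xs = _ ∷ xs} (x∉ ∷ _)   {Fin.suc i} {Fin.zero}  e = contradiction (sym e) (All.lookup x∉ (∈-lookup i))
lookup-injective {xs = _ ∷ xs} (_ ∷ xs!)  {Fin.suc i} {Fin.suc j} e = cong Fin.suc (lookup-injective xs! e)

unique⇒length≤ : {xs : List (Fin n)} → Unique xs → length xs ≤ n
unique⇒length≤ xs! = injective⇒≤ (lookup-injective xs!)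

≢? : (q v : Fin n) → Dec (v ≢ q)
≢? q v = ¬? (v ≟ᶠ q)

without : Fin n → List (Fin n) → List (Fin n)
without q = filter (≢? q)

∈-without⁻ : {q v : Fin n} (xs : List (Fin n)) → v ∈ without q xs → v ∈ xs × v ≢ q
∈-without⁻ {q = q} xs = ∈-filter⁻ (≢? q) {xs = xs}

length-without-∈ : {q : Fin n} {xs : List (Fin n)} → Unique xs → q ∈ xs →
                   suc (length (without q xs)) ≡ length xs
length-without-∈ {q = q} {q ∷ xs} (q∉ ∷ _) (here refl) = begin
  suc (length (without q (q ∷ xs)))  ≡⟨ cong (suc ∘ length) (filter-reject (≢? q) (λ ne → ne refl)) ⟩
  suc (length (without q xs))        ≡⟨ cong (suc ∘ length) (filter-all (≢? q) (All.map (λ ne → ne ∘ sym) q∉)) ⟩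
  suc (length xs)                    ∎
  where open ≡-Reasoning
length-without-∈ {q = q} {x ∷ xs} (x∉ ∷ xs!) (there q∈) = begin
  suc (length (without q (x ∷ xs)))  ≡⟨ cong (suc ∘ length) (filter-accept (≢? q) (All.lookup x∉ q∈)) ⟩
  suc (suc (length (without q xs)))  ≡⟨ cong suc (length-without-∈ xs! q∈) ⟩
  suc (length xs)                    ∎
  where open ≡-Reasoning

length-without-∉ : {q : Fin n} {xs : List (Fin n)} → q ∉ xs → length (without q xs) ≡ length xs
length-without-∉ {q = q} q∉ = cong length (filter-all (≢? q) (All.map (λ ne → ne ∘ sym) (All.¬Any⇒All¬ _ q∉)))

length-concatMap : ∀ {B : Set} (f : A → List B) {k} {xs : List A} →
                   All (λ x → length (f x) ≡ k) xs → length (concatMap f xs) ≡ k * length xs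
length-concatMap f {k} []                 = sym (*-zeroʳ k)
length-concatMap f {k} {x ∷ xs} (fx ∷ fxs) = begin
  length (f x ++ concatMap f xs)         ≡⟨ length-++ (f x) ⟩
  length (f x) + length (concatMap f xs) ≡⟨ cong₂ _+_ fx (length-concatMap f fxs) ⟩
  k + k * length xs                      ≡⟨ *-suc k (length xs) ⟨
  k * suc (length xs)                    ∎
  where open ≡-Reasoning

map⁺-injectiveOn : ∀ {B : Set} {P : A → Set} (f : A → B) {xs : List A} →
                   (∀ {x y} → P x → P y → f x ≡ f y → x ≡ y) → All P xs → Unique xs → Unique (map f xs)
map⁺-injectiveOn f inj []         []         = []
map⁺-injectiveOn f inj (px ∷ pxs) (x∉ ∷ xs!) =
  All.map⁺ (All.zipWith (λ (py , x≢y) fx≡fy → x≢y (inj px py fx≡fy)) (pxs , x∉))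
  ∷ map⁺-injectiveOn f inj pxs xs!

Unique[xs++x∷ys]⇒Unique[x∷xs] : ∀ (xs : List A) {x ys} → Unique (xs ++ x ∷ ys) → Unique (x ∷ xs)
Unique[xs++x∷ys]⇒Unique[x∷xs] []       _          = [] ∷ []
Unique[xs++x∷ys]⇒Unique[x∷xs] (y ∷ xs) (y∉ ∷ xs!) with Unique[xs++x∷ys]⇒Unique[x∷xs] xs xs!
... | x∉xs ∷ xs!′ = ((λ x≡y → y≢x (sym x≡y)) ∷ x∉xs) ∷ y∉xs ∷ xs!′
  where
  y∉xs = All.++⁻ˡ xs y∉
  y≢x  = All.head (All.++⁻ʳ xs y∉)

Unique-ʳ++⁻ʳ : ∀ (xs : List A) {ys} → Unique (xs ʳ++ ys) → Unique ys
Unique-ʳ++⁻ʳ []       ys! = ys!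
Unique-ʳ++⁻ʳ (x ∷ xs) xs! with Unique-ʳ++⁻ʳ xs xs!
... | _ ∷ ys! = ys!

ʳ++-repeat⇒¬Unique : ∀ {v : A} {xs ys} → v ∈ xs → v ∈ ys → ¬ Unique (xs ʳ++ ys)
ʳ++-repeat⇒¬Unique {xs = _ ∷ xs} (here refl) v∈ys xs! with Unique-ʳ++⁻ʳ xs xs!
... | v∉ys ∷ _ = All.lookup v∉ys v∈ys refl
ʳ++-repeat⇒¬Unique {xs = _ ∷ _} (there v∈xs) v∈ys = ʳ++-repeat⇒¬Unique v∈xs (there v∈ys)

last⇒∈ : ∀ {v : A} xs → last xs ≡ just v → v ∈ xs
last⇒∈ (x ∷ [])     refl = here refl
last⇒∈ (x ∷ y ∷ xs) eq   = there (last⇒∈ (y ∷ xs) eq)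

module _ {R : A → A → Set} where

  Linked-++⁻ˡ : ∀ xs {ys} → Linked R (xs ++ ys) → Linked R xs
  Linked-++⁻ˡ []           _         = []
  Linked-++⁻ˡ (x ∷ [])     _         = [-]
  Linked-++⁻ˡ (x ∷ y ∷ xs) (r ∷ rs) = r ∷ Linked-++⁻ˡ (y ∷ xs) rs

  Linked-ʳ++⁺ : ∀ {x xs ys} → Linked (flip R) (x ∷ xs) → Linked R (x ∷ ys) → Linked R (xs ʳ++ x ∷ ys)
  Linked-ʳ++⁺ [-]      rys = rys
  Linked-ʳ++⁺ (r ∷ rs) rys = Linked-ʳ++⁺ rs (r ∷ rys)

  Linked-∷ʳ⁺ : ∀ {xs x y} → last xs ≡ just x → R x y → Linked R xs → Linked R (xs ++ [ y ])
  Linked-∷ʳ⁺ last≡x r rs = Linked.++⁺ rs (subst (λ m → Connected R m (just _)) (sym last≡x) (just r)) [-]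

  Linked-lookup : ∀ {x} xs {ys} → Linked R (x ∷ xs ++ ys) → (i : Fin (length xs)) →
                  R (lookup (x ∷ xs) (Fin.inject₁ i)) (lookup xs i)
  Linked-lookup (y ∷ xs) (r ∷ _)  Fin.zero    = r
  Linked-lookup (y ∷ xs) (_ ∷ rs) (Fin.suc i) = Linked-lookup xs rs i

  Linked-last : ∀ {x} xs {y} → Linked R (x ∷ xs ++ [ y ]) → R (lookup (x ∷ xs) (Fin.fromℕ (length xs))) y
  Linked-last []       (r ∷ _)  = r
  Linked-last (_ ∷ xs) (_ ∷ rs) = Linked-last xs rs

data NonBacktracking {A : Set} : List A → Set where
  []    : NonBacktracking []
  [-]   : ∀ {x} → NonBacktracking [ x ]
  [-,-] : ∀ {x y} → NonBacktracking (x ∷ y ∷ [])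
  _∷_   : ∀ {x y z xs} → x ≢ z → NonBacktracking (y ∷ z ∷ xs) → NonBacktracking (x ∷ y ∷ z ∷ xs)

NonBacktracking-tail : ∀ {x : A} {xs} → NonBacktracking (x ∷ xs) → NonBacktracking xs
NonBacktracking-tail [-]      = []
NonBacktracking-tail [-,-]    = [-]
NonBacktracking-tail (_ ∷ nb) = nb

NonBacktracking-++⁻ˡ : ∀ (xs : List A) {ys} → NonBacktracking (xs ++ ys) → NonBacktracking xs
NonBacktracking-++⁻ˡ []               _         = []
NonBacktracking-++⁻ˡ (x ∷ [])         _         = [-]
NonBacktracking-++⁻ˡ (x ∷ y ∷ [])     _         = [-,-]
NonBacktracking-++⁻ˡ (x ∷ y ∷ z ∷ xs) (ne ∷ nb) = ne ∷ NonBacktracking-++⁻ˡ (y ∷ z ∷ xs) nb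

NonBacktracking-∷⁺ : ∀ {x y : A} {xs} → Connected _≢_ (just x) (head xs) →
                     NonBacktracking (y ∷ xs) → NonBacktracking (x ∷ y ∷ xs)
NonBacktracking-∷⁺ {xs = []}    _          _  = [-,-]
NonBacktracking-∷⁺ {xs = _ ∷ _} (just x≢z) nb = x≢z ∷ nb

NonBacktracking-head : ∀ {x y : A} {xs} → NonBacktracking (x ∷ y ∷ xs) → Connected _≢_ (just x) (head xs)
NonBacktracking-head [-,-]      = just-nothing
NonBacktracking-head (x≢z ∷ _) = just x≢z

NonBacktracking-ʳ++⁺ : ∀ {x : A} {xs ys} → NonBacktracking (x ∷ xs) → NonBacktracking (x ∷ ys) →
                       Connected _≢_ (head xs) (head ys) → NonBacktracking (xs ʳ++ x ∷ ys)
NonBacktracking-ʳ++⁺ {xs = []}    _  nys _ = nys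
NonBacktracking-ʳ++⁺ {xs = _ ∷ _} nxs nys c =
  NonBacktracking-ʳ++⁺ (NonBacktracking-tail nxs) (NonBacktracking-∷⁺ c nys)
    (Connected.sym (λ ne → ne ∘ sym) (NonBacktracking-head nxs))

last-∷ʳ : ∀ (xs : List A) {v} → last (xs ++ [ v ]) ≡ just v
last-∷ʳ []           = refl
last-∷ʳ (x ∷ [])     = refl
last-∷ʳ (x ∷ y ∷ xs) = last-∷ʳ (y ∷ xs)

last⇒¬NonBacktracking : ∀ {u v : A} xs → last xs ≡ just u → ¬ NonBacktracking (xs ++ v ∷ u ∷ [])
last⇒¬NonBacktracking (x ∷ [])     refl (u≢u ∷ _) = u≢u refl
last⇒¬NonBacktracking (x ∷ y ∷ xs) eq   nb        = last⇒¬NonBacktracking (y ∷ xs) eq (NonBacktracking-tail nb)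

geomSum-suc : ∀ b k → geomSum b (suc k) ≡ 1 + b * geomSum b k
geomSum-suc b zero    = refl
geomSum-suc b (suc k) = begin
  geomSum b (suc k) + b ^ suc (suc k)         ≡⟨ cong (_+ b ^ suc (suc k)) (geomSum-suc b k) ⟩
  1 + b * geomSum b k + b * b ^ suc k         ≡⟨ +-assoc 1 (b * geomSum b k) (b * b ^ suc k) ⟩
  1 + (b * geomSum b k + b * b ^ suc k)       ≡⟨ cong suc (*-distribˡ-+ b (geomSum b k) (b ^ suc k)) ⟨
  1 + b * geomSum b (suc k)                   ∎
  where open ≡-Reasoning

halves≤ : ∀ k m → k ≤ m → k + ((m ∸ k) / 2 + (m ∸ k) / 2) ≤ m
halves≤ k m k≤m = begin
  k + (h + h)   ≡⟨ cong (k +_) (trans (cong (h +_) (sym (+-identityʳ h))) (*-comm 2 h)) ⟩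
  k + h * 2     ≤⟨ +-monoʳ-≤ k (m/n*n≤m (m ∸ k) 2) ⟩
  k + (m ∸ k)   ≡⟨ m+[n∸m]≡n k≤m ⟩
  m             ∎
  where
  open ≤-Reasoning
  h = (m ∸ k) / 2

3+d≤ : ∀ {m} d → 3 ≤ m → 2 + (d + d) ≤ m → 3 + d ≤ m
3+d≤ zero    3≤m _      = 3≤m
3+d≤ (suc d) _   2+2d≤m = ≤-trans (+-monoʳ-≤ 4 (m≤m+n d d)) (≤-trans (≤-reflexive (cong (3 +_) (sym (+-suc d d)))) 2+2d≤m)

module Walks {n} (G : MixedGraph n) where

  V : Set
  V = Fin n

  open import Data.List.Membership.DecPropositional (_≟ᶠ_ {n}) using (_∈?_)

  infix 4 _—_
  _—_ : V → V → Set
  u — v = edge G u v ≡ true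

  —-sym : ∀ {u v} → u — v → v — u
  —-sym {u} {v} e = trans (edge-sym G v u) e

  step-irrefl : ∀ {v} → ¬ Step G v v
  step-irrefl {v} (inj₁ e) = contradiction (trans (sym (edge-irrefl G v)) e) λ ()
  step-irrefl {v} (inj₂ a) = contradiction (trans (sym (arc-irrefl G v)) a) λ ()

  closedWalk⇒cycle : ∀ {x} ys → Linked (Step G) (x ∷ ys ++ [ x ]) → Unique (x ∷ ys) → 2 ≤ length ys →
                     HasCycleOfLength G (suc (length ys))
  closedWalk⇒cycle {x} ys walk ys! 2≤ =
    s≤s 2≤ , lookup (x ∷ ys) , lookup-injective ys! , Linked-lookup ys walk , Linked-last ys walk

  ShorterCycle : List V → Set
  ShorterCycle W = ∃ λ k → k < length W × HasCycleOfLength G k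

  firstReturn⇒cycle : ∀ {x} ys {zs} → Linked (Step G) (x ∷ ys ++ x ∷ zs) → NonBacktracking (x ∷ ys ++ x ∷ zs) →
                      Unique (ys ++ x ∷ zs) → ShorterCycle (x ∷ ys ++ x ∷ zs)
  firstReturn⇒cycle []      (x→x ∷ _) _         _ = contradiction x→x step-irrefl
  firstReturn⇒cycle (_ ∷ []) _         (x≢x ∷ _) _ = contradiction refl x≢x
  firstReturn⇒cycle {x} ys@(_ ∷ _ ∷ _) {zs} walk _ ys! =
    suc (length ys) , length< , closedWalk⇒cycle ys loop (Unique[xs++x∷ys]⇒Unique[x∷xs] ys ys!) (s≤s (s≤s z≤n))
    where
    loop : Linked (Step G) (x ∷ ys ++ [ x ])
    loop = Linked-++⁻ˡ (x ∷ ys ++ [ x ]) (subst (Linked (Step G)) (cong (x ∷_) (sym (++-assoc ys [ x ] zs))) walk)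
    length< : suc (length ys) < length (x ∷ ys ++ x ∷ zs)
    length< = s≤s (≤-trans (m≤m+n (suc (length ys)) (length zs))
                           (≤-reflexive (trans (sym (+-suc (length ys) (length zs))) (sym (length-++ ys)))))

  unique⊎shorterCycle : ∀ W → Linked (Step G) W → NonBacktracking W → Unique W ⊎ ShorterCycle W
  unique⊎shorterCycle []      _    _  = inj₁ []
  unique⊎shorterCycle (x ∷ W) walk nb with unique⊎shorterCycle W (Linked.tail walk) (NonBacktracking-tail nb)
  ... | inj₂ (k , k< , cycle) = inj₂ (k , m<n⇒m<1+n k< , cycle)
  ... | inj₁ W! with x ∈? W
  ...   | no x∉W = inj₁ (All.¬Any⇒All¬ W x∉W ∷ W!)
  ...   | yes x∈W with ∈-∃++ x∈W
  ...     | ys , zs , refl = inj₂ (firstReturn⇒cycle ys walk nb W!)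

  edge⇒¬arc : ∀ {u w} → u — w → arc G u w ≢ true
  edge⇒¬arc {u} {w} e a = contradiction (trans (sym a) (edge-not-arc G u w e)) λ ()

  arc-then-edge-apart : ∀ {u w L} → arc G u w ≡ true → Linked _—_ (w ∷ L) → Connected _≢_ (just u) (head L)
  arc-then-edge-apart u→w [-]         = just-nothing
  arc-then-edge-apart u→w (w—y ∷ _) = just λ { refl → edge⇒¬arc (—-sym w—y) u→w }

  ArcAdjacent : V → V → Set
  ArcAdjacent u w = arc G u w ≡ true ⊎ arc G w u ≡ true

  record WalkTo (s : V) (W : List V) : Set where
    field
      edges           : Linked _—_ W
      nonBacktracking : NonBacktracking W
      endsAt          : last W ≡ just s

  WalkTo-tail : ∀ {s x y W} → WalkTo s (x ∷ y ∷ W) → WalkTo s (y ∷ W)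
  WalkTo-tail w = record
    { edges = Linked.tail (WalkTo.edges w)
    ; nonBacktracking = NonBacktracking-tail (WalkTo.nonBacktracking w)
    ; endsAt = WalkTo.endsAt w
    }

  edges⇒steps : ∀ {W} → Linked _—_ W → Linked (Step G) W
  edges⇒steps = Linked.map inj₁

  edges⇒backSteps : ∀ {W} → Linked _—_ W → Linked (flip (Step G)) W
  edges⇒backSteps = Linked.map (inj₁ ∘ —-sym)

  arcNeighbours : V → List V
  arcNeighbours u = select (arc G u) ++ select (λ w → arc G w u)

  ∈-arcNeighbours⁻ : ∀ {u w} → w ∈ arcNeighbours u → ArcAdjacent u w
  ∈-arcNeighbours⁻ {u} w∈ with ∈-++⁻ (select (arc G u)) w∈
  ... | inj₁ w∈out = inj₁ (∈-select⁻ w∈out)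
  ... | inj₂ w∈in  = inj₂ (∈-select⁻ w∈in)

  arcNeighbours-unique : ∀ u → Unique (arcNeighbours u)
  arcNeighbours-unique u = Unique.++⁺ (select-unique _) (select-unique _) λ (w∈out , w∈in) →
    contradiction (trans (sym (∈-select⁻ w∈in)) (arc-not-back G u _ (∈-select⁻ w∈out))) λ ()

  length-arcNeighbours : ∀ {z} → (∀ v → count (arc G v) ≡ z) → (∀ v → count (λ u → arc G u v) ≡ z) →
                         ∀ u → length (arcNeighbours u) ≡ 2 * z
  length-arcNeighbours {z} outRegular inRegular u = begin
    length (select (arc G u) ++ select (λ w → arc G w u))              ≡⟨ length-++ (select (arc G u)) ⟩
    length (select (arc G u)) + length (select (λ w → arc G w u))      ≡⟨ cong₂ _+_ (trans (length-select (arc G u)) (outRegular u))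
                                                                                        (trans (length-select (λ w → arc G w u)) (inRegular u)) ⟩
    z + z                                                              ≡⟨ cong (z +_) (+-identityʳ z) ⟨
    2 * z                                                              ∎
    where open ≡-Reasoning

  neighbours : V → List V
  neighbours v = select (edge G v)

  neighbour-exists : ∀ {v} → 1 ≤ count (edge G v) → ∃ λ u → v — u
  neighbour-exists {v} 1≤ with select (edge G v) | length-select (edge G v) | ∈-select⁻ {p = edge G v}
  ... | []    | len | _     = contradiction (subst (1 ≤_) (sym len) 1≤) λ ()
  ... | u ∷ _ | _   | sound = u , sound (here refl)

  -- A tree walk is stored reversed: its head is the current vertex and its last element the
  -- root s.  The first step may not go to p: with p = s this is no restriction, with s — p
  -- it gives the half of the tree around the edge s p that lies on the side of s.
  module MooreTree {r} (edgeRegular : ∀ v → count (edge G v) ≡ r) (s p : V) where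

    previous : List V → V
    previous (_ ∷ y ∷ _) = y
    previous _           = p

    children : List V → List (List V)
    children []          = []
    children W@(x ∷ _) = map (_∷ W) (without (previous W) (neighbours x))

    layer : ℕ → List (List V)
    layer zero    = [ [ s ] ]
    layer (suc d) = concatMap children (layer d)

    ball : ℕ → List (List V)
    ball zero    = layer zero
    ball (suc D) = ball D ++ layer (suc D)

    record TreeWalk (d : ℕ) (W : List V) : Set where
      field
        edges           : Linked _—_ W
        nonBacktracking : NonBacktracking (W ++ [ p ])
        endsAt          : last W ≡ just s
        length≡         : length W ≡ suc d

    child-treeWalk : ∀ {d x W z} → TreeWalk d (x ∷ W) → z ∈ without (previous (x ∷ W)) (neighbours x) →
                     TreeWalk (suc d) (z ∷ x ∷ W)
    child-treeWalk {x = x} {W} {z} tw z∈ with z∈neighbours , z≢previous ← ∈-without⁻ (neighbours x) z∈ = record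
      { edges           = —-sym (∈-select⁻ z∈neighbours) ∷ edges
      ; nonBacktracking = NonBacktracking-∷⁺ (apart W z≢previous) nonBacktracking
      ; endsAt          = endsAt
      ; length≡         = cong suc length≡
      }
      where
      open TreeWalk tw
      apart : ∀ W → z ≢ previous (x ∷ W) → Connected _≢_ (just z) (head (W ++ [ p ]))
      apart []      = just
      apart (_ ∷ _) = just

    children-treeWalk : ∀ {d W} → TreeWalk d W → All (TreeWalk (suc d)) (children W)
    children-treeWalk {W = []}    record { length≡ = () }
    children-treeWalk {W = _ ∷ _} tw = All.map⁺ (All.tabulate (child-treeWalk tw))

    layer-treeWalk : ∀ d → All (TreeWalk d) (layer d)
    layer-treeWalk zero    = record { edges = [-] ; nonBacktracking = [-,-] ; endsAt = refl ; length≡ = refl } ∷ []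
    layer-treeWalk (suc d) = All.concat⁺ (All.map⁺ (All.map children-treeWalk (layer-treeWalk d)))

    children-unique : ∀ W → Unique (children W)
    children-unique []      = []
    children-unique (_ ∷ _) = Unique.map⁺ ∷-injectiveˡ (Unique.filter⁺ _ (select-unique _))

    ∈-children⁻ : ∀ {U} W → U ∈ children W → ∃ λ z → U ≡ z ∷ W
    ∈-children⁻ W@(_ ∷ _) U∈ with z , _ , refl ← ∈-map⁻ (_∷ W) U∈ = z , refl

    children-disjoint : ∀ {W₁ W₂} → W₁ ≢ W₂ → Disjoint (children W₁) (children W₂)
    children-disjoint {W₁} {W₂} W₁≢W₂ (U∈₁ , U∈₂)
      with _ , refl ← ∈-children⁻ W₁ U∈₁ | _ , eq ← ∈-children⁻ W₂ U∈₂ = W₁≢W₂ (∷-injectiveʳ eq)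

    layer-unique : ∀ d → Unique (layer d)
    layer-unique zero    = [] ∷ []
    layer-unique (suc d) = Unique.concat⁺ (All.map⁺ (All.universal children-unique (layer d)))
                                          (AllPairs.map⁺ (AllPairs.map children-disjoint (layer-unique d)))

    length-children : ∀ x W → x — previous (x ∷ W) → length (children (x ∷ W)) ≡ r ∸ 1
    length-children x W x—q = begin
      length (children (x ∷ W))                     ≡⟨ length-map _ (without q (neighbours x)) ⟩
      length (without q (neighbours x))             ≡⟨⟩
      suc (length (without q (neighbours x))) ∸ 1   ≡⟨ cong (_∸ 1) (length-without-∈ (select-unique (edge G x)) (∈-select⁺ (edge G x) x—q)) ⟩
      length (neighbours x) ∸ 1                     ≡⟨ cong (_∸ 1) (trans (length-select (edge G x)) (edgeRegular x)) ⟩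
      r ∸ 1                                         ∎
      where
      open ≡-Reasoning
      q = previous (x ∷ W)

    length-children-deep : ∀ {d W} → TreeWalk (suc d) W → length (children W) ≡ r ∸ 1
    length-children-deep {W = []}        record { length≡ = () }
    length-children-deep {W = _ ∷ []}    record { length≡ = () }
    length-children-deep {W = x ∷ y ∷ W} tw = length-children x (y ∷ W) (Linked.head (TreeWalk.edges tw))

    length-layer : ∀ d → length (layer (suc d)) ≡ length (children [ s ]) * (r ∸ 1) ^ d
    length-layer zero    = trans (length-++ (children [ s ])) (trans (+-identityʳ _) (sym (*-identityʳ _)))
    length-layer (suc d) = begin
      length (concatMap children (layer (suc d)))  ≡⟨ length-concatMap children (All.map length-children-deep (layer-treeWalk (suc d))) ⟩
      (r ∸ 1) * length (layer (suc d))             ≡⟨ cong ((r ∸ 1) *_) (length-layer d) ⟩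
      (r ∸ 1) * (c * (r ∸ 1) ^ d)                  ≡⟨ *-comm (r ∸ 1) _ ⟩
      c * (r ∸ 1) ^ d * (r ∸ 1)                    ≡⟨ *-assoc c _ (r ∸ 1) ⟩
      c * ((r ∸ 1) ^ d * (r ∸ 1))                  ≡⟨ cong (c *_) (*-comm _ (r ∸ 1)) ⟩
      c * (r ∸ 1) ^ suc d                          ∎
      where
      open ≡-Reasoning
      c = length (children [ s ])

    length-ball : ∀ D → length (ball (suc D)) ≡ 1 + length (children [ s ]) * geomSum (r ∸ 1) D
    length-ball zero    = cong suc (length-layer zero)
    length-ball (suc D) = begin
      length (ball (suc D) ++ layer (suc (suc D)))                   ≡⟨ length-++ (ball (suc D)) ⟩
      length (ball (suc D)) + length (layer (suc (suc D)))           ≡⟨ cong₂ _+_ (length-ball D) (length-layer (suc D)) ⟩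
      1 + c * geomSum (r ∸ 1) D + c * (r ∸ 1) ^ suc D                ≡⟨ +-assoc 1 (c * geomSum (r ∸ 1) D) (c * (r ∸ 1) ^ suc D) ⟩
      1 + (c * geomSum (r ∸ 1) D + c * (r ∸ 1) ^ suc D)              ≡⟨ cong suc (*-distribˡ-+ c _ _) ⟨
      1 + c * geomSum (r ∸ 1) (suc D)                                ∎
      where
      open ≡-Reasoning
      c = length (children [ s ])

    length-children-root-loop : p ≡ s → length (children [ s ]) ≡ r
    length-children-root-loop refl = begin
      length (children [ s ])           ≡⟨ length-map _ (without s (neighbours s)) ⟩
      length (without s (neighbours s)) ≡⟨ length-without-∉ s∉neighbours ⟩
      length (neighbours s)             ≡⟨ trans (length-select (edge G s)) (edgeRegular s) ⟩
      r                                 ∎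
      where
      open ≡-Reasoning
      s∉neighbours : s ∉ neighbours s
      s∉neighbours s∈ = contradiction (trans (sym (∈-select⁻ s∈)) (edge-irrefl G s)) λ ()

    length-children-root-edge : s — p → length (children [ s ]) ≡ r ∸ 1
    length-children-root-edge = length-children s []

    TreeWalkWithin : ℕ → List V → Set
    TreeWalkWithin D W = ∃ λ d → d ≤ D × TreeWalk d W

    ball-within : ∀ D → All (TreeWalkWithin D) (ball D)
    ball-within zero    = All.map (λ tw → 0 , z≤n , tw) (layer-treeWalk 0)
    ball-within (suc D) = All.++⁺ (All.map (λ (d , d≤D , tw) → d , m≤n⇒m≤1+n d≤D , tw) (ball-within D))
                                  (All.map (λ tw → suc D , ≤-refl , tw) (layer-treeWalk (suc D)))

    ball-unique : ∀ D → Unique (ball D)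
    ball-unique zero    = layer-unique zero
    ball-unique (suc D) = Unique.++⁺ (ball-unique D) (layer-unique (suc D)) λ (W∈ball , W∈layer) →
      let (d , d≤D , tw) = All.lookup (ball-within D) W∈ball
          tw′            = All.lookup (layer-treeWalk (suc D)) W∈layer
      in <⇒≱ (s≤s d≤D) (≤-reflexive (suc-injective (trans (sym (TreeWalk.length≡ tw′)) (TreeWalk.length≡ tw))))

    -- The empty list never occurs in a tree; s is an arbitrary default.
    tip : List V → V
    tip []      = s
    tip (x ∷ _) = x

    tips : ℕ → List V
    tips D = map tip (ball D)

    length-tips-loop : p ≡ s → ∀ D → length (tips (suc D)) ≡ 1 + r * geomSum (r ∸ 1) D
    length-tips-loop p≡s D = begin
      length (tips (suc D))                            ≡⟨ length-map tip (ball (suc D)) ⟩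
      length (ball (suc D))                            ≡⟨ length-ball D ⟩
      1 + length (children [ s ]) * geomSum (r ∸ 1) D  ≡⟨ cong (λ c → 1 + c * geomSum (r ∸ 1) D) (length-children-root-loop p≡s) ⟩
      1 + r * geomSum (r ∸ 1) D                        ∎
      where open ≡-Reasoning

    length-tips-edge : s — p → ∀ D → length (tips D) ≡ geomSum (r ∸ 1) D
    length-tips-edge s—p zero    = refl
    length-tips-edge s—p (suc D) = begin
      length (tips (suc D))                            ≡⟨ length-map tip (ball (suc D)) ⟩
      length (ball (suc D))                            ≡⟨ length-ball D ⟩
      1 + length (children [ s ]) * geomSum (r ∸ 1) D  ≡⟨ cong (λ c → 1 + c * geomSum (r ∸ 1) D) (length-children-root-edge s—p) ⟩
      1 + (r ∸ 1) * geomSum (r ∸ 1) D                  ≡⟨ geomSum-suc (r ∸ 1) D ⟨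
      geomSum (r ∸ 1) (suc D)                          ∎
      where open ≡-Reasoning

    ∈-tips⁻ : ∀ {D x} → x ∈ tips D → ∃ λ L → TreeWalkWithin D (x ∷ L)
    ∈-tips⁻ {D} x∈ with ∈-map⁻ tip x∈
    ... | W , W∈ , refl with W | All.lookup (ball-within D) W∈
    ...   | []    | _ , _ , record { length≡ = () }
    ...   | _ ∷ L | within = L , within

    TreeWalkWithin-length : ∀ {D x L} → TreeWalkWithin D (x ∷ L) → length L ≤ D
    TreeWalkWithin-length (d , d≤D , tw) = ≤-trans (≤-reflexive (suc-injective (TreeWalk.length≡ tw))) d≤D

    TreeWalkWithin-length-via : ∀ {D x L} → TreeWalkWithin D (x ∷ L) → length (L ++ [ p ]) ≤ suc D
    TreeWalkWithin-length-via {L = L} w =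
      ≤-trans (≤-reflexive (trans (length-++ L) (+-comm (length L) 1))) (s≤s (TreeWalkWithin-length w))

    treeWalk⇒walkTo : ∀ {d W} → TreeWalk d W → WalkTo s W
    treeWalk⇒walkTo {W = W} tw = record
      { edges = TreeWalk.edges tw
      ; nonBacktracking = NonBacktracking-++⁻ˡ W (TreeWalk.nonBacktracking tw)
      ; endsAt = TreeWalk.endsAt tw
      }

    treeWalk⇒walkTo-via : s — p → ∀ {d W} → TreeWalk d W → WalkTo p (W ++ [ p ])
    treeWalk⇒walkTo-via s—p {W = W} tw = record
      { edges = Linked-∷ʳ⁺ (TreeWalk.endsAt tw) s—p (TreeWalk.edges tw)
      ; nonBacktracking = TreeWalk.nonBacktracking tw
      ; endsAt = last-∷ʳ W
      }

  module Girth {g} (noShortCycle : ∀ k → k < g → ¬ HasCycleOfLength G k) where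

    shortWalk-unique : ∀ {W} → Linked (Step G) W → NonBacktracking W → length W ≤ g → Unique W
    shortWalk-unique walk nb ≤g with unique⊎shorterCycle _ walk nb
    ... | inj₁ W!              = W!
    ... | inj₂ (k , k< , cycle) = contradiction cycle (noShortCycle k (≤-trans k< ≤g))

    closedWalkTo-trivial : ∀ {x} Q → WalkTo x (x ∷ Q) → length Q < g → Q ≡ []
    closedWalkTo-trivial []      _ _ = refl
    closedWalkTo-trivial (q ∷ Q) w lt with shortWalk-unique (edges⇒steps (WalkTo.edges w)) (WalkTo.nonBacktracking w) lt
    ... | x∉ ∷ _ = contradiction refl (All.lookup x∉ (last⇒∈ (q ∷ Q) (WalkTo.endsAt w)))

    -- Where the walks first differ, one of them reversed followed by the other is a
    -- non-backtracking closed walk shorter than g.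
    walkTo-unique : ∀ {s x} P Q → WalkTo s (x ∷ P) → WalkTo s (x ∷ Q) → length P + length Q < g → P ≡ Q
    walkTo-unique []      Q       record { endsAt = refl } wQ lt = sym (closedWalkTo-trivial Q wQ lt)
    walkTo-unique (p ∷ P) []      wP record { endsAt = refl } lt =
      closedWalkTo-trivial (p ∷ P) wP (subst (_< g) (+-identityʳ (length (p ∷ P))) lt)
    walkTo-unique {x = x} (p ∷ P) (q ∷ Q) wP wQ lt with p ≟ᶠ q
    ... | yes refl = cong (p ∷_) (walkTo-unique P Q (WalkTo-tail wP) (WalkTo-tail wQ)
                                  (≤-trans (s≤s (+-mono-≤ (n≤1+n _) (n≤1+n _))) lt))
    ... | no p≢q = contradiction (shortWalk-unique joined nbJoined length≤)
                     (ʳ++-repeat⇒¬Unique (last⇒∈ (p ∷ P) (WalkTo.endsAt wP))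
                                          (there (last⇒∈ (q ∷ Q) (WalkTo.endsAt wQ))))
      where
      joined : Linked (Step G) ((p ∷ P) ʳ++ x ∷ q ∷ Q)
      joined = Linked-ʳ++⁺ (edges⇒backSteps (WalkTo.edges wP)) (edges⇒steps (WalkTo.edges wQ))
      nbJoined : NonBacktracking ((p ∷ P) ʳ++ x ∷ q ∷ Q)
      nbJoined = NonBacktracking-ʳ++⁺ (WalkTo.nonBacktracking wP) (WalkTo.nonBacktracking wQ) (just p≢q)
      length≤ : length ((p ∷ P) ʳ++ x ∷ q ∷ Q) ≤ g
      length≤ = subst (_≤ g) (sym (trans (length-ʳ++ (p ∷ P)) (+-suc (length (p ∷ P)) (length (q ∷ Q))))) lt

    arcAdjacent-far : ∀ {u w} L → ArcAdjacent u w → WalkTo u (w ∷ L) → length (w ∷ L) < g → ⊥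
    arcAdjacent-far {u} {w} L (inj₁ u→w) wL lt =
      Unique.Unique[x∷xs]⇒x∉xs (shortWalk-unique joined nbJoined lt) (last⇒∈ (w ∷ L) (WalkTo.endsAt wL))
      where
      joined : Linked (Step G) (u ∷ w ∷ L)
      joined = inj₂ u→w ∷ edges⇒steps (WalkTo.edges wL)
      nbJoined : NonBacktracking (u ∷ w ∷ L)
      nbJoined = NonBacktracking-∷⁺ (arc-then-edge-apart u→w (WalkTo.edges wL)) (WalkTo.nonBacktracking wL)
    arcAdjacent-far {u} {w} [] (inj₂ w→u) record { endsAt = refl } _ =
      contradiction (trans (sym w→u) (arc-irrefl G w)) λ ()
    arcAdjacent-far {u} {w} L@(y ∷ _) (inj₂ w→u) wL lt =
      ʳ++-repeat⇒¬Unique (last⇒∈ L (WalkTo.endsAt wL)) (there (here refl)) (shortWalk-unique joined nbJoined length≤)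
      where
      joined : Linked (Step G) (L ʳ++ w ∷ u ∷ [])
      joined = Linked-ʳ++⁺ (edges⇒backSteps (WalkTo.edges wL)) (inj₂ w→u ∷ [-])
      nbJoined : NonBacktracking (L ʳ++ w ∷ u ∷ [])
      nbJoined = NonBacktracking-ʳ++⁺ (WalkTo.nonBacktracking wL) [-,-]
                   (just λ { refl → edge⇒¬arc (Linked.head (WalkTo.edges wL)) w→u })
      length≤ : length (L ʳ++ w ∷ u ∷ []) ≤ g
      length≤ = subst (_≤ g) (sym (trans (length-ʳ++ L) (+-comm (length L) 2))) lt

    module Trees {r} (edgeRegular : ∀ v → count (edge G v) ≡ r) where

      open MooreTree edgeRegular using (tip; tips; ball-within; ball-unique; ∈-tips⁻; TreeWalkWithin-length;
                                        TreeWalkWithin-length-via; treeWalk⇒walkTo; treeWalk⇒walkTo-via)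
      open MooreTree.TreeWalk

      tips-unique : ∀ s p D → D + D < g → Unique (tips s p D)
      tips-unique s p D lt = map⁺-injectiveOn (tip s p) sameTip⇒sameWalk (ball-within s p D) (ball-unique s p D)
        where
        sameTip⇒sameWalk : ∀ {W₁ W₂} → MooreTree.TreeWalkWithin edgeRegular s p D W₁ →
                           MooreTree.TreeWalkWithin edgeRegular s p D W₂ → tip s p W₁ ≡ tip s p W₂ → W₁ ≡ W₂
        sameTip⇒sameWalk {[]}    (_ , _ , record { length≡ = () }) _ _
        sameTip⇒sameWalk {_ ∷ _} {[]} _ (_ , _ , record { length≡ = () }) _
        sameTip⇒sameWalk {x ∷ P} {.x ∷ Q} w₁@(_ , _ , tw₁) w₂@(_ , _ , tw₂) refl =
          cong (x ∷_) (walkTo-unique P Q (treeWalk⇒walkTo s p tw₁) (treeWalk⇒walkTo s p tw₂)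
                         (≤-trans (s≤s (+-mono-≤ (TreeWalkWithin-length s p w₁) (TreeWalkWithin-length s p w₂))) lt))

      -- Extended by the edge u v, the first walk becomes a walk to v with the same tip, hence
      -- equals the second walk; but the second walk may not arrive at v from u.
      tips-disjoint : ∀ {u v} D → u — v → suc (D + D) < g → Disjoint (tips u v D) (tips v u D)
      tips-disjoint {u} {v} D u—v lt {x} (x∈₁ , x∈₂)
        with L₁ , w₁@(_ , _ , tw₁) ← ∈-tips⁻ u v {D} x∈₁ | L₂ , w₂@(_ , _ , tw₂) ← ∈-tips⁻ v u {D} x∈₂ =
        last⇒¬NonBacktracking (x ∷ L₁) (endsAt tw₁)
          (subst NonBacktracking (cong (x ∷_) (++-assoc L₁ [ v ] [ u ]))
            (subst (λ L → NonBacktracking ((x ∷ L) ++ [ u ])) (sym L₁v≡L₂) (nonBacktracking tw₂)))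
        where
        L₁v≡L₂ : L₁ ++ [ v ] ≡ L₂
        L₁v≡L₂ = walkTo-unique (L₁ ++ [ v ]) L₂ (treeWalk⇒walkTo-via u v u—v tw₁) (treeWalk⇒walkTo v u tw₂)
                   (≤-trans (s≤s (+-mono-≤ (TreeWalkWithin-length-via u v w₁) (TreeWalkWithin-length v u w₂))) lt)

      tips-apart-arcNeighbours : ∀ u p D → suc D < g → Disjoint (tips u p D) (arcNeighbours u)
      tips-apart-arcNeighbours u p D lt (x∈tips , x∈arcs)
        with L , w@(_ , _ , tw) ← ∈-tips⁻ u p {D} x∈tips =
        arcAdjacent-far L (∈-arcNeighbours⁻ x∈arcs) (treeWalk⇒walkTo u p tw)
          (≤-trans (s≤s (s≤s (TreeWalkWithin-length u p w))) lt)

      tips-via-apart-arcNeighbours : ∀ {u v} D → v — u → suc (suc D) < g → Disjoint (tips v u D) (arcNeighbours u)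
      tips-via-apart-arcNeighbours {u} {v} D v—u lt (x∈tips , x∈arcs)
        with L , w@(_ , _ , tw) ← ∈-tips⁻ v u {D} x∈tips =
        arcAdjacent-far (L ++ [ u ]) (∈-arcNeighbours⁻ x∈arcs) (treeWalk⇒walkTo-via v u v—u tw)
          (≤-trans (s≤s (s≤s (TreeWalkWithin-length-via v u w))) lt)

cycle-length≥3 : ∀ {n} {G : MixedGraph n} k → HasCycleOfLength G k → 3 ≤ k
cycle-length≥3 (suc _) (3≤k , _) = 3≤k

cycle-vertex : ∀ {n} {G : MixedGraph n} k → HasCycleOfLength G k → Fin n
cycle-vertex (suc _) (_ , c , _) = c Fin.zero

module Bounds {n} (G : MixedGraph n) {z r g}
         (outRegular : ∀ v → count (arc G v) ≡ z) (inRegular : ∀ v → count (λ u → arc G u v) ≡ z)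
         (edgeRegular : ∀ v → count (edge G v) ≡ r)
         (noShortCycle : ∀ k → k < g → ¬ HasCycleOfLength G k) where

  open Walks G
  open MooreTree edgeRegular using (tips; length-tips-loop; length-tips-edge)
  open Girth.Trees noShortCycle edgeRegular

  vertexBound : ∀ D → 3 + (D + D) ≤ g → Fin n → 1 + r * geomSum (r ∸ 1) D + 2 * z ≤ n
  vertexBound D lt v = begin
    1 + r * geomSum (r ∸ 1) D + 2 * z                    ≡⟨ size ⟨
    length (tips v v (suc D) ++ arcNeighbours v)         ≤⟨ unique⇒length≤ (Unique.++⁺ tips! (arcNeighbours-unique v) apart) ⟩
    n                                                    ∎
    where
    open ≤-Reasoning
    tips! = tips-unique v v (suc D) (≤-trans (≤-reflexive (cong (2 +_) (+-suc D D))) lt)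
    apart = tips-apart-arcNeighbours v v (suc D) (≤-trans (+-monoʳ-≤ 3 (m≤m+n D D)) lt)
    size : length (tips v v (suc D) ++ arcNeighbours v) ≡ 1 + r * geomSum (r ∸ 1) D + 2 * z
    size = begin-equality
      length (tips v v (suc D) ++ arcNeighbours v)          ≡⟨ length-++ (tips v v (suc D)) ⟩
      length (tips v v (suc D)) + length (arcNeighbours v)  ≡⟨ cong₂ _+_ (length-tips-loop v v refl D)
                                                                          (length-arcNeighbours outRegular inRegular v) ⟩
      1 + r * geomSum (r ∸ 1) D + 2 * z                     ∎

  edgeBound : ∀ D → 2 + (D + D) ≤ g → 3 ≤ g → ∀ {u v} → u — v → 2 * geomSum (r ∸ 1) D + 2 * z ≤ n
  edgeBound D lt 3≤g {u} {v} u—v = begin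
    2 * geomSum (r ∸ 1) D + 2 * z                              ≡⟨ size ⟨
    length ((tips u v D ++ tips v u D) ++ arcNeighbours u)     ≤⟨ unique⇒length≤ (Unique.++⁺ tips! (arcNeighbours-unique u) apart) ⟩
    n                                                          ∎
    where
    open ≤-Reasoning
    tips! : Unique (tips u v D ++ tips v u D)
    tips! = Unique.++⁺ (tips-unique u v D (≤-trans (n≤1+n _) lt))
                       (tips-unique v u D (≤-trans (n≤1+n _) lt))
                       (tips-disjoint D u—v lt)
    apart : Disjoint (tips u v D ++ tips v u D) (arcNeighbours u)
    apart (x∈tips , x∈arcs) with ∈-++⁻ (tips u v D) x∈tips
    ... | inj₁ x∈ = tips-apart-arcNeighbours u v D (≤-trans (+-monoʳ-≤ 2 (m≤m+n D D)) lt) (x∈ , x∈arcs)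
    ... | inj₂ x∈ = tips-via-apart-arcNeighbours D (—-sym u—v) (3+d≤ D 3≤g lt) (x∈ , x∈arcs)
    size : length ((tips u v D ++ tips v u D) ++ arcNeighbours u) ≡ 2 * geomSum (r ∸ 1) D + 2 * z
    size = begin-equality
      length ((tips u v D ++ tips v u D) ++ arcNeighbours u)     ≡⟨ length-++ (tips u v D ++ tips v u D) ⟩
      length (tips u v D ++ tips v u D) + length arcs            ≡⟨ cong (_+ length arcs) (length-++ (tips u v D)) ⟩
      length (tips u v D) + length (tips v u D) + length arcs    ≡⟨ cong₂ _+_ (cong₂ _+_ (length-tips-edge u v u—v D)
                                                                                          (length-tips-edge v u (—-sym u—v) D))
                                                                              (length-arcNeighbours outRegular inRegular u) ⟩
      S + S + 2 * z                                              ≡⟨ cong (λ t → S + t + 2 * z) (+-identityʳ S) ⟨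
      2 * S + 2 * z                                              ∎
      where
      arcs = arcNeighbours u
      S    = geomSum (r ∸ 1) D

mainTheorem5 : (z r g : ℕ) → 1 ≤ r → {n : ℕ} → (G : MixedGraph n) →
    IsMixedCage z r g G → n₀ r g + 2 * z ≤ n
mainTheorem5 z r g 1≤r {n} G (((outRegular , inRegular , edgeRegular) , cycle , noShortCycle) , _) =
  mooreBound (cycle-length≥3 g cycle) (cycle-vertex g cycle)
  where
  open Bounds G outRegular inRegular edgeRegular noShortCycle
  mooreBound : 3 ≤ g → Fin n → n₀ r g + 2 * z ≤ n
  mooreBound 3≤g v with g % 2
  ... | zero  = edgeBound ((g ∸ 2) / 2) (halves≤ 2 g (≤-trans (n≤1+n 2) 3≤g)) 3≤g
                  (proj₂ (Walks.neighbour-exists G (subst (1 ≤_) (sym (edgeRegular v)) 1≤r)))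
  ... | suc _ = vertexBound ((g ∸ 3) / 2) (halves≤ 3 g 3≤g) v
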